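{- Let $m\geq 3$ with $m\neq 4$, and let $d\equiv 5\pmod 6$. There exists a subgroup $H$ of $\mathbb Z_2^{m-1}\times\mathbb Z_{4d}$ with $H\cong\mathbb Z_2^m$ and a $(\mathbb Z_2^{m-1}\times\mathbb Z_{4d},H,3,1)$-difference family.
   Context: Let $(G,+)$ be a finite abelian group and $H$ a subgroup. For a triple $T=\{a,b,c\}$ of three distinct elements of $G$, $\Delta T$ is the multiset $\{\pm(a-b),\pm(a-c),\pm(b-c)\}$, and for a set $\mathcal T$ of triples, $\Delta\mathcal T$ is the multiset union of the $\Delta T$. A $(G,H,3,1)$-difference family is a set $\mathcal T$ of triples of $G$ with $\Delta\mathcal T=G\setminus H$ as multisets (each element of $G\setminus H$ occurs exactly once, elements of $H$ do not occur). -}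

module Defs where

open import Data.Nat using (ℕ; zero; suc; _+_; _*_; _∸_)
open import Data.Nat.DivMod using (_mod_)
open import Data.Fin using (Fin; toℕ)
open import Data.Vec using (Vec; zipWith; replicate)
open import Data.Product using (Σ; ∃; _×_; _,_; proj₁; proj₂)
open import Data.List using (List; []; _∷_; concatMap)
open import Data.List.Membership.Propositional using (_∈_)
open import Data.List.Relation.Unary.All using (All)
open import Data.List.Relation.Unary.Unique.Propositional using (Unique)
open import Relation.Binary.PropositionalEquality using (_≡_; _≢_)
open import Relation.Nullary using (¬_)
open import Function.Definitions using (Injective)

-- Arithmetic in ℤ_n, with ℤ_n represented by Fin n (n = 0 is vacuous).
_+ₙ_ : ∀ {n} → Fin n → Fin n → Fin n
_+ₙ_ {suc n} a b = (toℕ a + toℕ b) mod suc n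

_-ₙ_ : ∀ {n} → Fin n → Fin n → Fin n
_-ₙ_ {suc n} a b = (toℕ a + (suc n ∸ toℕ b)) mod suc n

Grp : ℕ → ℕ → Set
Grp k n = Vec (Fin 2) k × Fin n

_⊕_ : ∀ {k n} → Grp k n → Grp k n → Grp k n
(u , x) ⊕ (v , y) = zipWith _+ₙ_ u v , x +ₙ y

_⊖_ : ∀ {k n} → Grp k n → Grp k n → Grp k n
(u , x) ⊖ (v , y) = zipWith _-ₙ_ u v , x -ₙ y

_⊕₂_ : ∀ {m} → Vec (Fin 2) m → Vec (Fin 2) m → Vec (Fin 2) m
u ⊕₂ v = zipWith _+ₙ_ u v

IsHom : ∀ {m k n} → (Vec (Fin 2) m → Grp k n) → Set
IsHom φ = ∀ u v → φ (u ⊕₂ v) ≡ φ u ⊕ φ v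

-- A subgroup isomorphic to ℤ₂^m is the image of an injective homomorphism from ℤ₂^m.
record Elem2Subgroup (m k n : ℕ) : Set where
  field
    φ     : Vec (Fin 2) m → Grp k n
    hom   : IsHom φ
    inj   : Injective _≡_ _≡_ φ

_∈H_ : ∀ {m k n} → Grp k n → Elem2Subgroup m k n → Set
g ∈H H = ∃ λ v → Elem2Subgroup.φ H v ≡ g

Triple : ℕ → ℕ → Set
Triple k n = Grp k n × Grp k n × Grp k n

DistinctTriple : ∀ {k n} → Triple k n → Set
DistinctTriple (a , b , c) = a ≢ b × a ≢ c × b ≢ c

Δ : ∀ {k n} → Triple k n → List (Grp k n)
Δ (a , b , c) = (a ⊖ b) ∷ (b ⊖ a) ∷ (a ⊖ c) ∷ (c ⊖ a) ∷ (b ⊖ c) ∷ (c ⊖ b) ∷ []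

Δ* : ∀ {k n} → List (Triple k n) → List (Grp k n)
Δ* = concatMap Δ

-- (G,H,3,1)-difference family: ΔT = G ∖ H as multisets, i.e. ΔT has no repeated
-- element, contains no element of H, and contains every element of G ∖ H.
IsDifferenceFamily : ∀ {m k n} → Elem2Subgroup m k n → List (Triple k n) → Set
IsDifferenceFamily {k = k} {n} H 𝒯 =
  All DistinctTriple 𝒯 ×
  Unique (Δ* 𝒯) ×
  All (λ g → ¬ (g ∈H H)) (Δ* 𝒯) ×
  (∀ (g : Grp k n) → ¬ (g ∈H H) → g ∈ Δ* 𝒯)

-- Let G = ℤ₂^(m−1) × ℤ_{4d} and H = ℤ₂^(m−1) × {0, 2d} ≅ ℤ₂^m. A list of |G ∖ H| / 6 triples whose
-- differences cover G ∖ H is already a (G, H, 3, 1)-difference family: together with the elements of H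
-- its differences form a list of length |G| containing every element of G, so none is repeated.
-- Such a covering is first built in ℤ₂² × ℤ_{4d}. For d = 5 an explicit family is checked by computation.
-- For d = 11 + 6s, base blocks {0, a, b} of ℤ_{4d}, arranged in arithmetic strands, have differences
-- ±a, ±b, ±(b − a) meeting every residue except 0, 2d and ± six special values; an orthomorphism of ℤ₂²
-- attaches all labels in ℤ₂² to them, and eight labelled blocks cover ℤ₂² × (± the special values).
-- Finally an orthomorphism σ of ℤ₂ᵏ lifts a covering of ℤ₂ʲ × ℤ_M to one of ℤ₂^(j+k) × ℤ_M, replacing
-- each triple {x, y, z} by the triples {(x, 0), (y, t), (z, σ t)}, t ∈ ℤ₂ᵏ. Orthomorphisms of ℤ₂ᵏ exist
-- for every k ≠ 1, whence the condition m ≠ 4.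

module Submission where

open import Defs
open import Data.Nat using (ℕ; _≤_; _*_; _∸_; _%_)
open import Data.Product using (Σ)
open import Data.List using (List)
open import Relation.Binary.PropositionalEquality using (_≡_; _≢_)

open import Data.Bool using (Bool; T; _∧_)
open import Data.Bool.Properties using (T-∧)
open import Data.Empty using (⊥-elim)
open import Data.Fin using (Fin; toℕ; fromℕ<; zero; suc)
import Data.Fin as Fin
open import Data.Fin.Properties using (toℕ-fromℕ<; toℕ<n; toℕ-injective)
open import Data.List
  using ([]; _∷_; _++_; [_]; map; concatMap; length; applyUpTo; cartesianProduct; cartesianProductWith; allFin; foldr)
open import Data.List.Membership.Propositional using (_∈_; lose; find)
open import Data.List.Membership.Propositional.Properties
  using (∈-map⁺; ∈-map⁻; ∈-++⁺ˡ; ∈-++⁺ʳ; ∈-concatMap⁺; ∈-concatMap⁻; ∈-applyUpTo⁺; ∈-applyUpTo⁻; ∈-∃++;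
         ∈-allFin; ∈-cartesianProduct⁺; ∈-cartesianProductWith⁺)
import Data.List.Membership.DecPropositional as DecMembership
open import Data.List.Properties using (length-++; length-map; length-applyUpTo; length-tabulate; concatMap-++)
open import Data.List.Relation.Binary.Disjoint.Propositional using (Disjoint)
open import Data.List.Relation.Binary.Permutation.Propositional using (_↭_; ↭-sym; ↭⇒↭ₛ)
open import Data.List.Relation.Binary.Permutation.Propositional.Properties using (shift; ∈-resp-↭; ↭-length)
import Data.List.Relation.Binary.Permutation.Setoid.Properties as Permutationₛ
open import Data.List.Relation.Unary.All using (All; []; _∷_; all?)
import Data.List.Relation.Unary.All as All
open import Data.List.Relation.Unary.AllPairs using ([]; _∷_)
open import Data.List.Relation.Unary.Any using (here; there; any?; satisfied)
open import Data.List.Relation.Unary.Unique.Propositional using (Unique)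
import Data.List.Relation.Unary.Unique.Propositional.Properties as Unique
open import Data.Nat using (zero; suc; _+_; _^_; _<_; z≤n; s≤s; s≤s⁻¹; _<?_; _≤ᵇ_)
import Data.Nat as ℕ
open import Data.Nat.DivMod using (_mod_; _/_; m<n⇒m%n≡m; [m+n]%n≡m%n; n%n≡0; m≡m%n+[m/n]*n)
open import Data.Nat.Properties
open import Data.Nat.Tactic.RingSolver using (solve-∀)
open import Data.Product using (∃; _×_; _,_; proj₁; proj₂)
import Data.Product.Properties as Product
open import Data.Sum using (_⊎_; inj₁; inj₂)
open import Data.Vec using (Vec; []; _∷_; zipWith; replicate; splitAt; take; drop) renaming (_++_ to _++ᵥ_)
import Data.Vec.Properties as Vec
open import Function.Bundles using (Equivalence)
open import Function.Definitions using (Injective)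
open import Relation.Binary.Definitions using (DecidableEquality; tri<; tri≈; tri>)
open import Relation.Binary.PropositionalEquality
  using (refl; sym; trans; cong; cong₂; subst; subst₂; setoid; module ≡-Reasoning)
open import Relation.Nullary using (¬_; Dec; yes; no)
open import Relation.Nullary.Decidable using (True; toWitness; map′; _⊎-dec_)

module _ {n : ℕ} where

  toℕ-mod : ∀ {a} → a < suc n → toℕ (a mod suc n) ≡ a
  toℕ-mod a<n = trans (toℕ-fromℕ< _) (m<n⇒m%n≡m a<n)

  toℕ--ₙ-≥ : (x y : Fin (suc n)) → toℕ y ≤ toℕ x → toℕ (x -ₙ y) ≡ toℕ x ∸ toℕ y
  toℕ--ₙ-≥ x y y≤x = begin
    toℕ ((toℕ x + (suc n ∸ toℕ y)) mod suc n) ≡⟨ toℕ-fromℕ< _ ⟩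
    (toℕ x + (suc n ∸ toℕ y)) % suc n         ≡⟨ cong (_% suc n) (+-∸-assoc (toℕ x) (<⇒≤ (toℕ<n y))) ⟨
    (toℕ x + suc n ∸ toℕ y) % suc n           ≡⟨ cong (_% suc n) (+-∸-comm (suc n) y≤x) ⟩
    (toℕ x ∸ toℕ y + suc n) % suc n           ≡⟨ [m+n]%n≡m%n (toℕ x ∸ toℕ y) (suc n) ⟩
    (toℕ x ∸ toℕ y) % suc n                   ≡⟨ m<n⇒m%n≡m (≤-<-trans (m∸n≤m (toℕ x) (toℕ y)) (toℕ<n x)) ⟩
    toℕ x ∸ toℕ y                             ∎
    where open ≡-Reasoning

  toℕ--ₙ-< : (x y : Fin (suc n)) → toℕ x < toℕ y → toℕ (x -ₙ y) ≡ suc n ∸ (toℕ y ∸ toℕ x)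
  toℕ--ₙ-< x y x<y = begin
    toℕ ((toℕ x + (suc n ∸ toℕ y)) mod suc n) ≡⟨ toℕ-mod x+[M-y]<M ⟩
    toℕ x + (suc n ∸ toℕ y)                   ≡⟨ +-∸-assoc (toℕ x) y≤M ⟨
    toℕ x + suc n ∸ toℕ y                     ≡⟨ cong (toℕ x + suc n ∸_) (m+[n∸m]≡n (<⇒≤ x<y)) ⟨
    toℕ x + suc n ∸ (toℕ x + (toℕ y ∸ toℕ x)) ≡⟨ [m+n]∸[m+o]≡n∸o (toℕ x) (suc n) (toℕ y ∸ toℕ x) ⟩
    suc n ∸ (toℕ y ∸ toℕ x)                   ∎
    where
    open ≡-Reasoning
    y≤M : toℕ y ≤ suc n
    y≤M = <⇒≤ (toℕ<n y)
    x+[M-y]<M : toℕ x + (suc n ∸ toℕ y) < suc n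
    x+[M-y]<M = subst (toℕ x + (suc n ∸ toℕ y) <_) (m+[n∸m]≡n y≤M) (+-monoˡ-< (suc n ∸ toℕ y) x<y)

  +ₙ-identityʳ : (x : Fin (suc n)) → x +ₙ zero ≡ x
  +ₙ-identityʳ x = toℕ-injective (trans (cong (λ a → toℕ (a mod suc n)) (+-identityʳ (toℕ x))) (toℕ-mod (toℕ<n x)))

  +ₙ-identityˡ : (x : Fin (suc n)) → zero +ₙ x ≡ x
  +ₙ-identityˡ x = toℕ-injective (toℕ-mod (toℕ<n x))

  -ₙ-identityʳ : (x : Fin (suc n)) → x -ₙ zero ≡ x
  -ₙ-identityʳ x = toℕ-injective (toℕ--ₙ-≥ x zero z≤n)

  -ₙ-self : (x : Fin (suc n)) → x -ₙ x ≡ zero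
  -ₙ-self x = toℕ-injective (trans (toℕ--ₙ-≥ x x ≤-refl) (n∸n≡0 (toℕ x)))

  toℕ-mod-ₙ-mod-≥ : ∀ {a b} → b ≤ a → a < suc n → toℕ ((a mod suc n) -ₙ (b mod suc n)) ≡ a ∸ b
  toℕ-mod-ₙ-mod-≥ {a} {b} b≤a a<M = begin
    toℕ ((a mod suc n) -ₙ (b mod suc n))
      ≡⟨ toℕ--ₙ-≥ (a mod suc n) (b mod suc n) (subst₂ _≤_ (sym (toℕ-mod b<M)) (sym (toℕ-mod a<M)) b≤a) ⟩
    toℕ (a mod suc n) ∸ toℕ (b mod suc n)
      ≡⟨ cong₂ _∸_ (toℕ-mod a<M) (toℕ-mod b<M) ⟩
    a ∸ b
      ∎
    where
    open ≡-Reasoning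
    b<M : b < suc n
    b<M = ≤-<-trans b≤a a<M

  toℕ-mod-ₙ-mod-< : ∀ {a b} → a < b → b < suc n → toℕ ((a mod suc n) -ₙ (b mod suc n)) ≡ suc n ∸ (b ∸ a)
  toℕ-mod-ₙ-mod-< {a} {b} a<b b<M = begin
    toℕ ((a mod suc n) -ₙ (b mod suc n))
      ≡⟨ toℕ--ₙ-< (a mod suc n) (b mod suc n) (subst₂ _<_ (sym (toℕ-mod a<M)) (sym (toℕ-mod b<M)) a<b) ⟩
    suc n ∸ (toℕ (b mod suc n) ∸ toℕ (a mod suc n))
      ≡⟨ cong (suc n ∸_) (cong₂ _∸_ (toℕ-mod b<M) (toℕ-mod a<M)) ⟩
    suc n ∸ (b ∸ a)
      ∎
    where
    open ≡-Reasoning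
    a<M : a < suc n
    a<M = <-trans a<b b<M

  infix 4 _≡±_

  _≡±_ : Fin (suc n) → ℕ → Set
  z ≡± c = toℕ z ≡ c ⊎ toℕ z ≡ suc n ∸ c

pattern 𝟙 = suc zero

zero-ₙ₂ : (x : Fin 2) → zero -ₙ x ≡ x
zero-ₙ₂ zero = refl
zero-ₙ₂ 𝟙    = refl

-ₙ-comm₂ : (x y : Fin 2) → x -ₙ y ≡ y -ₙ x
-ₙ-comm₂ zero zero = refl
-ₙ-comm₂ zero 𝟙    = refl
-ₙ-comm₂ 𝟙    zero = refl
-ₙ-comm₂ 𝟙    𝟙    = refl

infixl 6 _⊖ᵥ_

_⊖ᵥ_ : ∀ {q k} → Vec (Fin q) k → Vec (Fin q) k → Vec (Fin q) k
_⊖ᵥ_ = zipWith _-ₙ_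

0ᵥ : ∀ {q k} → Vec (Fin (suc q)) k
0ᵥ = replicate _ zero

module _ {q : ℕ} where

  ⊖ᵥ-identityʳ : ∀ {k} (u : Vec (Fin (suc q)) k) → u ⊖ᵥ 0ᵥ ≡ u
  ⊖ᵥ-identityʳ = Vec.zipWith-identityʳ -ₙ-identityʳ

  ⊖ᵥ-self : ∀ {k} (u : Vec (Fin (suc q)) k) → u ⊖ᵥ u ≡ 0ᵥ
  ⊖ᵥ-self []      = refl
  ⊖ᵥ-self (x ∷ u) = cong₂ _∷_ (-ₙ-self x) (⊖ᵥ-self u)

  ⊖ᵥ-++ : ∀ {j k} (a b : Vec (Fin q) j) (c d : Vec (Fin q) k) →
          (a ++ᵥ c) ⊖ᵥ (b ++ᵥ d) ≡ a ⊖ᵥ b ++ᵥ c ⊖ᵥ d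
  ⊖ᵥ-++ a b c d = Vec.zipWith-++ _-ₙ_ a c b d

0ᵥ-⊖ᵥ : ∀ {k} (u : Vec (Fin 2) k) → 0ᵥ ⊖ᵥ u ≡ u
0ᵥ-⊖ᵥ = Vec.zipWith-identityˡ zero-ₙ₂

⊖ᵥ-comm₂ : ∀ {k} (u v : Vec (Fin 2) k) → u ⊖ᵥ v ≡ v ⊖ᵥ u
⊖ᵥ-comm₂ []      []      = refl
⊖ᵥ-comm₂ (x ∷ u) (y ∷ v) = cong₂ _∷_ (-ₙ-comm₂ x y) (⊖ᵥ-comm₂ u v)

0ᴳ : ∀ {k n} → Grp k (suc n)
0ᴳ = 0ᵥ , zero

⊖-self : ∀ {k n} (p : Grp k (suc n)) → p ⊖ p ≡ 0ᴳ
⊖-self (u , x) = cong₂ _,_ (⊖ᵥ-self u) (-ₙ-self x)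

length-cartesianProductWith : ∀ {A B C : Set} (f : A → B → C) xs ys →
                              length (cartesianProductWith f xs ys) ≡ length xs * length ys
length-cartesianProductWith f []       ys = refl
length-cartesianProductWith f (x ∷ xs) ys = begin
  length (map (f x) ys ++ cartesianProductWith f xs ys)     ≡⟨ length-++ (map (f x) ys) ⟩
  length (map (f x) ys) + length (cartesianProductWith f xs ys)
    ≡⟨ cong₂ _+_ (length-map (f x) ys) (length-cartesianProductWith f xs ys) ⟩
  length ys + length xs * length ys                         ∎
  where open ≡-Reasoning

module _ {q : ℕ} where

  allVecs : ∀ k → List (Vec (Fin q) k)
  allVecs zero    = [] ∷ []
  allVecs (suc k) = cartesianProductWith _∷_ (allFin q) (allVecs k)

  ∈-allVecs : ∀ {k} (v : Vec (Fin q) k) → v ∈ allVecs k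
  ∈-allVecs []      = here refl
  ∈-allVecs (x ∷ v) = ∈-cartesianProductWith⁺ _∷_ (∈-allFin x) (∈-allVecs v)

  allVecs-unique : ∀ k → Unique (allVecs k)
  allVecs-unique zero    = [] ∷ []
  allVecs-unique (suc k) = Unique.cartesianProductWith⁺ _∷_ Vec.∷-injective (Unique.allFin⁺ q) (allVecs-unique k)

  length-allVecs : ∀ k → length (allVecs k) ≡ q ^ k
  length-allVecs zero    = refl
  length-allVecs (suc k) = trans (length-cartesianProductWith _∷_ (allFin q) (allVecs k))
                                 (cong₂ _*_ (length-tabulate {n = q} (λ x → x)) (length-allVecs k))

elements : ∀ k n → List (Grp k n)
elements k n = cartesianProduct (allVecs k) (allFin n)

∈-elements : ∀ {k n} (g : Grp k n) → g ∈ elements k n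
∈-elements (u , x) = ∈-cartesianProduct⁺ (∈-allVecs u) (∈-allFin x)

elements-unique : ∀ k n → Unique (elements k n)
elements-unique k n = Unique.cartesianProduct⁺ (allVecs-unique k) (Unique.allFin⁺ n)

length-elements : ∀ k n → length (elements k n) ≡ 2 ^ k * n
length-elements k n = trans (length-cartesianProductWith _,_ (allVecs k) (allFin n))
                            (cong₂ _*_ (length-allVecs k) (length-tabulate {n = n} (λ x → x)))

_≟ᴳ_ : ∀ {k n} → DecidableEquality (Grp k n)
_≟ᴳ_ = Product.≡-dec (Vec.≡-dec Fin._≟_) Fin._≟_

hasPreimage? : ∀ {q m} {B : Set} → DecidableEquality B → (f : Vec (Fin q) m → B) → ∀ b → Dec (∃ λ u → f u ≡ b)
hasPreimage? {m = m} _≟_ f b =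
  map′ satisfied (λ (u , fu≡b) → lose (∈-allVecs u) fu≡b) (any? (λ u → f u ≟ b) (allVecs m))

-- Difference families from coverings

∈Δ*⁺ : ∀ {k n} {𝒯 : List (Triple k n)} {τ g} → τ ∈ 𝒯 → g ∈ Δ τ → g ∈ Δ* 𝒯
∈Δ*⁺ τ∈𝒯 g∈Δτ = ∈-concatMap⁺ Δ (lose τ∈𝒯 g∈Δτ)

∈Δ*⁻ : ∀ {k n} (𝒯 : List (Triple k n)) {g} → g ∈ Δ* 𝒯 → ∃ λ τ → τ ∈ 𝒯 × g ∈ Δ τ
∈Δ*⁻ 𝒯 g∈ = find (∈-concatMap⁻ Δ {xs = 𝒯} g∈)

module _ {k n : ℕ} (𝒯 𝒰 : List (Triple k n)) where

  ∈Δ*-++⁺ˡ : ∀ {g} → g ∈ Δ* 𝒯 → g ∈ Δ* (𝒯 ++ 𝒰)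
  ∈Δ*-++⁺ˡ g∈ = subst (_ ∈_) (sym (concatMap-++ Δ 𝒯 𝒰)) (∈-++⁺ˡ g∈)

  ∈Δ*-++⁺ʳ : ∀ {g} → g ∈ Δ* 𝒰 → g ∈ Δ* (𝒯 ++ 𝒰)
  ∈Δ*-++⁺ʳ g∈ = subst (_ ∈_) (sym (concatMap-++ Δ 𝒯 𝒰)) (∈-++⁺ʳ (Δ* 𝒯) g∈)

length-Δ* : ∀ {k n} (𝒯 : List (Triple k n)) → length (Δ* 𝒯) ≡ 6 * length 𝒯
length-Δ* []      = refl
length-Δ* (τ ∷ 𝒯) = trans (cong (6 +_) (length-Δ* 𝒯)) (sym (*-suc 6 (length 𝒯)))

Covers : ∀ {m k n} → Elem2Subgroup m k n → List (Triple k n) → Set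
Covers {k = k} {n} H 𝒯 = ∀ (g : Grp k n) → ¬ (g ∈H H) → g ∈ Δ* 𝒯

_∈H?_ : ∀ {m k n} (g : Grp k n) (H : Elem2Subgroup m k n) → Dec (g ∈H H)
g ∈H? H = hasPreimage? _≟ᴳ_ (Elem2Subgroup.φ H) g

_∈Δ*?_ : ∀ {k n} (g : Grp k n) 𝒯 → Dec (g ∈ Δ* 𝒯)
g ∈Δ*? 𝒯 = DecMembership._∈?_ _≟ᴳ_ g (Δ* 𝒯)

covers-by-search : ∀ {m k n} (H : Elem2Subgroup m k n) 𝒯 →
                   {True (all? (λ g → (g ∈H? H) ⊎-dec (g ∈Δ*? 𝒯)) (elements k n))} → Covers H 𝒯
covers-by-search H 𝒯 {found} g g∉H with All.lookup (toWitness found) (∈-elements g)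
... | inj₁ g∈H  = ⊥-elim (g∉H g∈H)
... | inj₂ g∈Δ* = g∈Δ*

module _ {A : Set} where

  Unique-++⁻ : ∀ (xs : List A) {ys} → Unique (xs ++ ys) → Unique xs × Disjoint xs ys
  Unique-++⁻ []       _              = [] , λ ()
  Unique-++⁻ (x ∷ xs) {ys} (x∉xs++ys ∷ xs++ys!) = x∉xs ∷ proj₁ rest , disjoint
    where
    rest : Unique xs × Disjoint xs ys
    rest = Unique-++⁻ xs xs++ys!
    x∉xs : All (x ≢_) xs
    x∉xs = All.tabulate λ y∈xs → All.lookup x∉xs++ys (∈-++⁺ˡ y∈xs)
    disjoint : Disjoint (x ∷ xs) ys
    disjoint (here refl , x∈ys) = All.lookup x∉xs++ys (∈-++⁺ʳ xs x∈ys) refl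
    disjoint (there y∈xs , y∈ys) = proj₂ rest (y∈xs , y∈ys)

  unique-of-⊇-shorter : ∀ {xs ys : List A} → Unique xs → (∀ {x} → x ∈ xs → x ∈ ys) → length ys ≤ length xs →
                        Unique ys × (∀ {y} → y ∈ ys → y ∈ xs)
  unique-of-⊇-shorter {[]}     {[]}    _ _ _  = [] , λ ()
  unique-of-⊇-shorter {[]}     {_ ∷ _} _ _ ()
  unique-of-⊇-shorter {x ∷ xs} (x∉xs ∷ xs!) xs⊆ys len with ys₁ , ys₂ , refl ← ∈-∃++ (xs⊆ys (here refl)) =
    Permutationₛ.Unique-resp-↭ (setoid A) (↭⇒↭ₛ (↭-sym p)) (All.tabulate x∉rest ∷ proj₁ rest-unique) , ys⊆xs
    where
    p : ys₁ ++ [ x ] ++ ys₂ ↭ x ∷ ys₁ ++ ys₂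
    p = shift x ys₁ ys₂
    xs⊆rest : ∀ {y} → y ∈ xs → y ∈ ys₁ ++ ys₂
    xs⊆rest y∈xs with ∈-resp-↭ p (xs⊆ys (there y∈xs))
    ... | here refl   = ⊥-elim (All.lookup x∉xs y∈xs refl)
    ... | there y∈rest = y∈rest
    rest-unique : Unique (ys₁ ++ ys₂) × (∀ {y} → y ∈ ys₁ ++ ys₂ → y ∈ xs)
    rest-unique = unique-of-⊇-shorter xs! xs⊆rest (s≤s⁻¹ (subst (_≤ suc (length xs)) (↭-length p) len))
    x∉rest : ∀ {y} → y ∈ ys₁ ++ ys₂ → x ≢ y
    x∉rest y∈rest refl = All.lookup x∉xs (proj₂ rest-unique y∈rest) refl
    ys⊆xs : ∀ {y} → y ∈ ys₁ ++ [ x ] ++ ys₂ → y ∈ x ∷ xs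
    ys⊆xs y∈ys with ∈-resp-↭ p y∈ys
    ... | here refl    = here refl
    ... | there y∈rest = there (proj₂ rest-unique y∈rest)

module _ {m k n : ℕ} (H : Elem2Subgroup m k (suc n)) where
  open Elem2Subgroup H

  differenceFamily-of-covering : ∀ {𝒯} → 0ᴳ ∈H H → Covers H 𝒯 → 6 * length 𝒯 + 2 ^ m ≡ 2 ^ k * suc n →
                                 IsDifferenceFamily H 𝒯
  differenceFamily-of-covering {𝒯} 0∈H covers size = distinct , Δ*-unique , Δ*-avoids-H , covers
    where
    Hs Δ*∪H : List (Grp k (suc n))
    Hs = map φ (allVecs m)
    Δ*∪H = Δ* 𝒯 ++ Hs

    elements⊆Δ*∪H : ∀ {g} → g ∈ elements k (suc n) → g ∈ Δ*∪H
    elements⊆Δ*∪H {g} _ with g ∈H? H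
    ... | yes (v , refl) = ∈-++⁺ʳ (Δ* 𝒯) (∈-map⁺ φ (∈-allVecs v))
    ... | no g∉H         = ∈-++⁺ˡ (covers g g∉H)

    length-Δ*∪H : length Δ*∪H ≡ length (elements k (suc n))
    length-Δ*∪H = begin
      length (Δ* 𝒯 ++ Hs)            ≡⟨ length-++ (Δ* 𝒯) ⟩
      length (Δ* 𝒯) + length Hs
        ≡⟨ cong₂ _+_ (length-Δ* 𝒯) (trans (length-map φ (allVecs m)) (length-allVecs m)) ⟩
      6 * length 𝒯 + 2 ^ m           ≡⟨ size ⟩
      2 ^ k * suc n                  ≡⟨ length-elements k (suc n) ⟨
      length (elements k (suc n))    ∎
      where open ≡-Reasoning

    split : Unique (Δ* 𝒯) × Disjoint (Δ* 𝒯) Hs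
    split = Unique-++⁻ (Δ* 𝒯)
      (proj₁ (unique-of-⊇-shorter (elements-unique k (suc n)) elements⊆Δ*∪H (≤-reflexive length-Δ*∪H)))

    Δ*-unique : Unique (Δ* 𝒯)
    Δ*-unique = proj₁ split

    Δ*-avoids-H : All (λ g → ¬ (g ∈H H)) (Δ* 𝒯)
    Δ*-avoids-H = All.tabulate λ g∈Δ* (v , φv≡g) →
      proj₂ split (g∈Δ* , subst (_∈ Hs) φv≡g (∈-map⁺ φ (∈-allVecs v)))

    distinct-ends : ∀ {τ p q} → τ ∈ 𝒯 → p ⊖ q ∈ Δ τ → p ≢ q
    distinct-ends {p = p} τ∈𝒯 p⊖q∈Δτ refl =
      All.lookup Δ*-avoids-H (∈Δ*⁺ τ∈𝒯 p⊖q∈Δτ) (subst (_∈H H) (sym (⊖-self p)) 0∈H)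

    distinct : All DistinctTriple 𝒯
    distinct = All.tabulate λ { {_ , _ , _} τ∈𝒯 →
      distinct-ends τ∈𝒯 (here refl) , distinct-ends τ∈𝒯 (there (there (here refl))) ,
      distinct-ends τ∈𝒯 (there (there (there (there (here refl))))) }

DifferenceFamily : ℕ → ℕ → ℕ → Set
DifferenceFamily m k n = Σ (Elem2Subgroup m k n) λ H → Σ (List (Triple k n)) (IsDifferenceFamily H)

-- Orthomorphisms and lifting

-- Surjectivity of σ and of u ↦ u − σ u; on the finite group ℤ₂ᵏ this is the usual notion.
record Orthomorphism (k : ℕ) : Set where
  field
    σ             : Vec (Fin 2) k → Vec (Fin 2) k
    σ-surjective  : ∀ v → ∃ λ u → σ u ≡ v
    ⊖σ-surjective : ∀ v → ∃ λ u → u ⊖ᵥ σ u ≡ v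

surjective-by-search : ∀ {q k} (f : Vec (Fin q) k → Vec (Fin q) k) →
                       {True (all? (hasPreimage? (Vec.≡-dec Fin._≟_) f) (allVecs k))} → ∀ v → ∃ λ u → f u ≡ v
surjective-by-search f {found} v = All.lookup (toWitness found) (∈-allVecs v)

orthomorphism₀ : Orthomorphism 0
orthomorphism₀ = record
  { σ = λ u → u ; σ-surjective = surjective-by-search _ ; ⊖σ-surjective = surjective-by-search _ }

-- Multiplication by x in 𝔽₄ = 𝔽₂[x]/(x² + x + 1); then u − σ u is multiplication by 1 + x ≠ 0.
orthomorphism₂ : Orthomorphism 2
orthomorphism₂ = record
  { σ = σ ; σ-surjective = surjective-by-search σ ; ⊖σ-surjective = surjective-by-search (λ u → u ⊖ᵥ σ u) }
  where
  σ : Vec (Fin 2) 2 → Vec (Fin 2) 2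
  σ (a ∷ b ∷ []) = b ∷ a +ₙ b ∷ []

-- Multiplication by x in 𝔽₈ = 𝔽₂[x]/(x³ + x + 1).
orthomorphism₃ : Orthomorphism 3
orthomorphism₃ = record
  { σ = σ ; σ-surjective = surjective-by-search σ ; ⊖σ-surjective = surjective-by-search (λ u → u ⊖ᵥ σ u) }
  where
  σ : Vec (Fin 2) 3 → Vec (Fin 2) 3
  σ (a ∷ b ∷ c ∷ []) = c ∷ a +ₙ c ∷ b ∷ []

module _ {A : Set} (j : ℕ) {k : ℕ} (a : Vec A j) (b : Vec A k) where

  take-++ : take j (a ++ᵥ b) ≡ a
  take-++ = sym (Vec.++-injectiveˡ a (take j (a ++ᵥ b)) (proj₂ (proj₂ (splitAt j (a ++ᵥ b)))))

  drop-++ : drop j (a ++ᵥ b) ≡ b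
  drop-++ = sym (Vec.++-injectiveʳ a (take j (a ++ᵥ b)) (proj₂ (proj₂ (splitAt j (a ++ᵥ b)))))

_⊗_ : ∀ {j k} → Orthomorphism j → Orthomorphism k → Orthomorphism (j + k)
_⊗_ {j} {k} O₁ O₂ = record { σ = σ ; σ-surjective = σ-surjective ; ⊖σ-surjective = ⊖σ-surjective }
  where
  module O₁ = Orthomorphism O₁
  module O₂ = Orthomorphism O₂

  σ : Vec (Fin 2) (j + k) → Vec (Fin 2) (j + k)
  σ u = O₁.σ (take j u) ++ᵥ O₂.σ (drop j u)

  σ-++ : ∀ a b → σ (a ++ᵥ b) ≡ O₁.σ a ++ᵥ O₂.σ b
  σ-++ a b = cong₂ (λ x y → O₁.σ x ++ᵥ O₂.σ y) (take-++ j a b) (drop-++ j a b)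

  σ-surjective : ∀ v → ∃ λ u → σ u ≡ v
  σ-surjective v with a , b , refl ← splitAt j v =
    let u₁ , σu₁≡a = O₁.σ-surjective a
        u₂ , σu₂≡b = O₂.σ-surjective b
    in u₁ ++ᵥ u₂ , trans (σ-++ u₁ u₂) (cong₂ _++ᵥ_ σu₁≡a σu₂≡b)

  ⊖σ-surjective : ∀ v → ∃ λ u → u ⊖ᵥ σ u ≡ v
  ⊖σ-surjective v with a , b , refl ← splitAt j v =
    let u₁ , δu₁≡a = O₁.⊖σ-surjective a
        u₂ , δu₂≡b = O₂.⊖σ-surjective b
        open ≡-Reasoning
    in u₁ ++ᵥ u₂ , (begin
      (u₁ ++ᵥ u₂) ⊖ᵥ σ (u₁ ++ᵥ u₂)             ≡⟨ cong ((u₁ ++ᵥ u₂) ⊖ᵥ_) (σ-++ u₁ u₂) ⟩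
      (u₁ ++ᵥ u₂) ⊖ᵥ (O₁.σ u₁ ++ᵥ O₂.σ u₂)     ≡⟨ ⊖ᵥ-++ u₁ (O₁.σ u₁) u₂ (O₂.σ u₂) ⟩
      u₁ ⊖ᵥ O₁.σ u₁ ++ᵥ u₂ ⊖ᵥ O₂.σ u₂          ≡⟨ cong₂ _++ᵥ_ δu₁≡a δu₂≡b ⟩
      a ++ᵥ b                                  ∎)

-- ℤ₂ has none: u − σ u is constant for both permutations σ of ℤ₂.
orthomorphism : ∀ k → k ≢ 1 → Orthomorphism k
orthomorphism 0                     _   = orthomorphism₀
orthomorphism 1                     1≢1 = ⊥-elim (1≢1 refl)
orthomorphism 2                     _   = orthomorphism₂
orthomorphism 3                     _   = orthomorphism₃
orthomorphism (suc (suc k@(suc (suc _)))) _ = orthomorphism₂ ⊗ orthomorphism k λ ()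

module Lift {k : ℕ} (O : Orthomorphism k) where
  open Orthomorphism O

  liftTriple : ∀ {j n} → Vec (Fin 2) k → Triple j n → Triple (j + k) n
  liftTriple s ((u₀ , z₀) , (u₁ , z₁) , (u₂ , z₂)) =
    (u₀ ++ᵥ 0ᵥ , z₀) , (u₁ ++ᵥ s , z₁) , (u₂ ++ᵥ σ s , z₂)

  lifts : ∀ {j n} → Triple j n → List (Triple (j + k) n)
  lifts τ = map (λ s → liftTriple s τ) (allVecs k)

  lift : ∀ {j n} → List (Triple j n) → List (Triple (j + k) n)
  lift = concatMap lifts

  length-lift : ∀ {j n} (𝒯 : List (Triple j n)) → length (lift 𝒯) ≡ length 𝒯 * 2 ^ k
  length-lift []      = refl
  length-lift (τ ∷ 𝒯) = begin
    length (lifts τ ++ lift 𝒯)         ≡⟨ length-++ (lifts τ) ⟩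
    length (lifts τ) + length (lift 𝒯)
      ≡⟨ cong₂ _+_ (trans (length-map _ (allVecs k)) (length-allVecs k)) (length-lift 𝒯) ⟩
    2 ^ k + length 𝒯 * 2 ^ k         ∎
    where open ≡-Reasoning

  private
    ++-difference : ∀ {j n} {a b : Vec (Fin 2) j} {c d v : Vec (Fin 2) k} {z : Fin n} →
                    c ⊖ᵥ d ≡ v → (a ⊖ᵥ b ++ᵥ v , z) ≡ ((a ++ᵥ c) ⊖ᵥ (b ++ᵥ d) , z)
    ++-difference {a = a} {b} {c} {d} c⊖d≡v = cong (_, _) (sym (trans (⊖ᵥ-++ a b c d) (cong (a ⊖ᵥ b ++ᵥ_) c⊖d≡v)))

  -- The six differences of liftTriple s τ have ℤ₂ᵏ-components s, s, σ s, σ s, s − σ s and σ s − s.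
  ∈Δ-lift : ∀ {j n} {τ : Triple j n} {u z} → (u , z) ∈ Δ τ →
            ∀ v → ∃ λ s → (u ++ᵥ v , z) ∈ Δ (liftTriple s τ)
  ∈Δ-lift {τ = _ , _ , _} (here refl) v = v , here (++-difference (0ᵥ-⊖ᵥ v))
  ∈Δ-lift {τ = _ , _ , _} (there (here refl)) v = v , there (here (++-difference (⊖ᵥ-identityʳ v)))
  ∈Δ-lift {τ = _ , _ , _} (there (there (here refl))) v =
    let s , σs≡v = σ-surjective v
    in s , there (there (here (++-difference (trans (0ᵥ-⊖ᵥ (σ s)) σs≡v))))
  ∈Δ-lift {τ = _ , _ , _} (there (there (there (here refl)))) v =
    let s , σs≡v = σ-surjective v
    in s , there (there (there (here (++-difference (trans (⊖ᵥ-identityʳ (σ s)) σs≡v)))))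
  ∈Δ-lift {τ = _ , _ , _} (there (there (there (there (here refl))))) v =
    let s , δs≡v = ⊖σ-surjective v
    in s , there (there (there (there (here (++-difference δs≡v)))))
  ∈Δ-lift {τ = _ , _ , _} (there (there (there (there (there (here refl)))))) v =
    let s , δs≡v = ⊖σ-surjective v
    in s , there (there (there (there (there (here (++-difference (trans (⊖ᵥ-comm₂ (σ s) s) δs≡v)))))))

  ∈Δ*-lift : ∀ {j n} (𝒯 : List (Triple j n)) {u z} → (u , z) ∈ Δ* 𝒯 →
             ∀ v → (u ++ᵥ v , z) ∈ Δ* (lift 𝒯)
  ∈Δ*-lift 𝒯 g∈ v =
    let τ , τ∈𝒯 , g∈Δτ = ∈Δ*⁻ 𝒯 g∈
        s , g′∈Δτ′ = ∈Δ-lift g∈Δτ v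
    in ∈Δ*⁺ (∈-concatMap⁺ lifts (lose τ∈𝒯 (∈-map⁺ (λ s → liftTriple s τ) (∈-allVecs s)))) g′∈Δτ′

-- The subgroup ℤ₂ᵏ × {0, h} of ℤ₂ᵏ × ℤ_{2h}

module HalfSubgroup {n h : ℕ} (h+h≡M : h + h ≡ suc n) (0<h : 0 < h) where

  half : Fin (suc n)
  half = fromℕ< (subst (h <_) h+h≡M (m<m+n h 0<h))

  toℕ-half : toℕ half ≡ h
  toℕ-half = toℕ-fromℕ< _

  half+half : half +ₙ half ≡ zero
  half+half = toℕ-injective (begin
    toℕ ((toℕ half + toℕ half) mod suc n) ≡⟨ toℕ-fromℕ< _ ⟩
    (toℕ half + toℕ half) % suc n         ≡⟨ cong (_% suc n) (cong₂ _+_ toℕ-half toℕ-half) ⟩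
    (h + h) % suc n                       ≡⟨ cong (_% suc n) h+h≡M ⟩
    suc n % suc n                         ≡⟨ n%n≡0 (suc n) ⟩
    0                                     ∎)
    where open ≡-Reasoning

  half≢zero : half ≢ zero
  half≢zero half≡0 = <⇒≢ 0<h (trans (sym (cong toℕ half≡0)) toℕ-half)

  ι : Fin 2 → Fin (suc n)
  ι zero = zero
  ι 𝟙    = half

  ι-hom : ∀ a b → ι (a +ₙ b) ≡ ι a +ₙ ι b
  ι-hom zero zero = sym (+ₙ-identityʳ zero)
  ι-hom zero 𝟙    = sym (+ₙ-identityˡ half)
  ι-hom 𝟙    zero = sym (+ₙ-identityʳ half)
  ι-hom 𝟙    𝟙    = sym half+half

  ι-injective : Injective _≡_ _≡_ ι
  ι-injective {zero} {zero} _      = refl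
  ι-injective {zero} {𝟙}    0≡half = ⊥-elim (half≢zero (sym 0≡half))
  ι-injective {𝟙}    {zero} half≡0 = ⊥-elim (half≢zero half≡0)
  ι-injective {𝟙}    {𝟙}    _      = refl

  embed : ∀ {k} → Vec (Fin 2) (suc k) → Grp k (suc n)
  embed (e ∷ u) = u , ι e

  embed-hom : ∀ {k} → IsHom (embed {k})
  embed-hom (e ∷ u) (f ∷ v) = cong (u ⊕₂ v ,_) (ι-hom e f)

  embed-injective : ∀ {k} → Injective _≡_ _≡_ (embed {k})
  embed-injective {x = e ∷ u} {f ∷ v} eq with Product.,-injective eq
  ... | u≡v , ιe≡ιf = cong₂ _∷_ (ι-injective ιe≡ιf) u≡v

  H : ∀ k → Elem2Subgroup (suc k) k (suc n)
  H k = record { φ = embed ; hom = embed-hom ; inj = embed-injective }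

  zero∈H : ∀ {k} (u : Vec (Fin 2) k) → (u , zero) ∈H H k
  zero∈H u = zero ∷ u , refl

  half∈H : ∀ {k} (u : Vec (Fin 2) k) → (u , half) ∈H H k
  half∈H u = 𝟙 ∷ u , refl

  ∈H⁻ : ∀ {k u z} → (u , z) ∈H H k → z ≡ zero ⊎ z ≡ half
  ∈H⁻ (zero ∷ _ , refl) = inj₁ refl
  ∈H⁻ (𝟙 ∷ _ , refl)    = inj₂ refl

  ∉H⇒≡± : ∀ {k u z} → ¬ ((u , z) ∈H H k) → ∃ λ c → 0 < c × c < h × z ≡± c
  ∉H⇒≡± {u = u} {z} z∉H with <-cmp (toℕ z) h
  ... | tri< z<h _ _ = toℕ z , n≢0⇒n>0 z≢0 , z<h , inj₁ refl
    where
    z≢0 : toℕ z ≢ 0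
    z≢0 z≡0 = z∉H (subst (λ x → (u , x) ∈H H _) (sym (toℕ-injective {j = zero} z≡0)) (zero∈H u))
  ... | tri≈ _ z≡h _ =
    ⊥-elim (z∉H (subst (λ x → (u , x) ∈H H _) (toℕ-injective (trans toℕ-half (sym z≡h))) (half∈H u)))
  ... | tri> _ _ h<z = suc n ∸ toℕ z , m<n⇒0<n∸m (toℕ<n z) , M-z<h , inj₂ (sym (m∸[m∸n]≡n (<⇒≤ (toℕ<n z))))
    where
    M-z<h : suc n ∸ toℕ z < h
    M-z<h = subst (suc n ∸ toℕ z <_) (trans (cong (_∸ h) (sym h+h≡M)) (m+n∸n≡m h h))
                  (∸-monoʳ-< h<z (<⇒≤ (toℕ<n z)))

  covers-lift : ∀ {j k} (O : Orthomorphism k) {𝒯 : List (Triple j (suc n))} →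
                Covers (H j) 𝒯 → Covers (H (j + k)) (Lift.lift O 𝒯)
  covers-lift {j} O {𝒯} covers (w , z) w∉H with u , v , refl ← splitAt j w =
    Lift.∈Δ*-lift O 𝒯 (covers (u , z) u∉H) v
    where
    u∉H : ¬ ((u , z) ∈H H j)
    u∉H u∈H with ∈H⁻ u∈H
    ... | inj₁ refl = w∉H (zero∈H (u ++ᵥ v))
    ... | inj₂ refl = w∉H (half∈H (u ++ᵥ v))

  lift-differenceFamily : ∀ {j k} → Orthomorphism k → {𝒯 : List (Triple j (suc n))} →
                          Covers (H j) 𝒯 → 6 * length 𝒯 + 2 ^ suc j ≡ 2 ^ j * suc n →
                          DifferenceFamily (suc (j + k)) (j + k) (suc n)
  lift-differenceFamily {j} {k} O {𝒯} covers size =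
    H (j + k) , Lift.lift O 𝒯 ,
    differenceFamily-of-covering (H (j + k)) (zero∈H 0ᵥ) (covers-lift O {𝒯} covers) lifted-size
    where
    open ≡-Reasoning
    regroup : ∀ t p q → 6 * (t * q) + 2 * (p * q) ≡ (6 * t + 2 * p) * q
    regroup = solve-∀
    reorder : ∀ p m q → p * m * q ≡ p * q * m
    reorder = solve-∀
    lifted-size : 6 * length (Lift.lift O 𝒯) + 2 ^ suc (j + k) ≡ 2 ^ (j + k) * suc n
    lifted-size = begin
      6 * length (Lift.lift O 𝒯) + 2 * 2 ^ (j + k)
        ≡⟨ cong₂ (λ x y → 6 * x + 2 * y) (Lift.length-lift O 𝒯) (^-distribˡ-+-* 2 j k) ⟩
      6 * (length 𝒯 * 2 ^ k) + 2 * (2 ^ j * 2 ^ k)   ≡⟨ regroup (length 𝒯) (2 ^ j) (2 ^ k) ⟩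
      (6 * length 𝒯 + 2 ^ suc j) * 2 ^ k             ≡⟨ cong (_* 2 ^ k) size ⟩
      2 ^ j * suc n * 2 ^ k                          ≡⟨ reorder (2 ^ j) (suc n) (2 ^ k) ⟩
      2 ^ j * 2 ^ k * suc n                          ≡⟨ cong (_* suc n) (^-distribˡ-+-* 2 j k) ⟨
      2 ^ (j + k) * suc n                            ∎

positiveDifferences : ℕ × ℕ → List ℕ
positiveDifferences (A , B) = A ∷ B ∷ B ∸ A ∷ []

module _ {n : ℕ} where

  triple₀ : ∀ {j} → Vec (Fin 2) j → ℕ → Vec (Fin 2) j → ℕ → Triple j (suc n)
  triple₀ v P w Q = (0ᵥ , zero) , (v , P mod suc n) , (w , Q mod suc n)

  module _ {j} (v w : Vec (Fin 2) j) {P Q} (0<P : 0 < P) (P<Q : P < Q) (Q<M : Q < suc n) where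

    private
      P<M : P < suc n
      P<M = <-trans P<Q Q<M

      same : ∀ {u u′ : Vec (Fin 2) j} {z z′ : Fin (suc n)} {c} →
             u ≡ u′ → toℕ z ≡ c → toℕ z′ ≡ c → (u , z) ≡ (u′ , z′)
      same u≡u′ z≡c z′≡c = cong₂ _,_ u≡u′ (toℕ-injective (trans z≡c (sym z′≡c)))

    ∈Δ-triple₀ˡ : ∀ {z} → z ≡± P → (v , z) ∈ Δ (triple₀ v P w Q)
    ∈Δ-triple₀ˡ (inj₁ z≡P)  = there (here (same (sym (⊖ᵥ-identityʳ v)) z≡P (toℕ-mod-ₙ-mod-≥ z≤n P<M)))
    ∈Δ-triple₀ˡ (inj₂ z≡-P) = here (same (sym (0ᵥ-⊖ᵥ v)) z≡-P (toℕ-mod-ₙ-mod-< 0<P P<M))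

    ∈Δ-triple₀ʳ : ∀ {z} → z ≡± Q → (w , z) ∈ Δ (triple₀ v P w Q)
    ∈Δ-triple₀ʳ (inj₁ z≡Q)  = there (there (there (here (same (sym (⊖ᵥ-identityʳ w)) z≡Q (toℕ-mod-ₙ-mod-≥ z≤n Q<M)))))
    ∈Δ-triple₀ʳ (inj₂ z≡-Q) = there (there (here (same (sym (0ᵥ-⊖ᵥ w)) z≡-Q (toℕ-mod-ₙ-mod-< (<-trans 0<P P<Q) Q<M))))

    ∈Δ-triple₀ᵈ : ∀ {z} → z ≡± Q ∸ P → (w ⊖ᵥ v , z) ∈ Δ (triple₀ v P w Q)
    ∈Δ-triple₀ᵈ (inj₁ z≡D)  = there (there (there (there (there (here (same refl z≡D (toℕ-mod-ₙ-mod-≥ (<⇒≤ P<Q) Q<M)))))))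
    ∈Δ-triple₀ᵈ (inj₂ z≡-D) = there (there (there (there (here (same (⊖ᵥ-comm₂ w v) z≡-D (toℕ-mod-ₙ-mod-< P<Q Q<M))))))

  ∈Δ-triple₀-positive : ∀ {A B c z} → 0 < A → A < B → B < suc n → c ∈ positiveDifferences (A , B) → z ≡± c →
                        ([] , z) ∈ Δ (triple₀ [] A [] B)
  ∈Δ-triple₀-positive 0<A A<B B<M (here refl)                 = ∈Δ-triple₀ˡ [] [] 0<A A<B B<M
  ∈Δ-triple₀-positive 0<A A<B B<M (there (here refl))         = ∈Δ-triple₀ʳ [] [] 0<A A<B B<M
  ∈Δ-triple₀-positive 0<A A<B B<M (there (there (here refl))) = ∈Δ-triple₀ᵈ [] [] 0<A A<B B<M

HoldsOn : (ℕ → Set) → ℕ → ℕ → Set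
HoldsOn P lo hi = ∀ {c} → lo ≤ c → c < hi → P c

module _ {P : ℕ → Set} where

  infixr 4 _∪_

  _∪_ : ∀ {lo mid hi} → HoldsOn P lo mid → HoldsOn P mid hi → HoldsOn P lo hi
  _∪_ {mid = mid} left right {c} lo≤c c<hi with c <? mid
  ... | yes c<mid = left lo≤c c<mid
  ... | no  c≮mid = right (≮⇒≥ c≮mid) c<hi

  point : ∀ {x} → P x → HoldsOn P x (suc x)
  point px x≤c c<sx = subst P (≤-antisym x≤c (s≤s⁻¹ c<sx)) px

  ascending : ∀ {lo K hi} → lo + K ≡ hi → (∀ {i} → i < K → P (lo + i)) → HoldsOn P lo hi
  ascending {lo} refl p lo≤c c<hi =
    subst P (m+[n∸m]≡n lo≤c) (p (+-cancelˡ-< lo _ _ (subst (_< _) (sym (m+[n∸m]≡n lo≤c)) c<hi)))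

  descending : ∀ {lo K top} → lo + K ≡ suc top → (∀ {i} → i < K → P (top ∸ i)) → HoldsOn P lo (suc top)
  descending {lo} {K} {top} lo+K≡1+top p {c} lo≤c c<1+top = subst P (m∸[m∸n]≡n c≤top) (p top-c<K)
    where
    c≤top : c ≤ top
    c≤top = s≤s⁻¹ c<1+top
    top-c<K : top ∸ c < K
    top-c<K = begin-strict
      top ∸ c        ≤⟨ ∸-monoʳ-≤ top lo≤c ⟩
      top ∸ lo       <⟨ ∸-monoˡ-< (n<1+n top) (≤-trans lo≤c c≤top) ⟩
      suc top ∸ lo   ≡⟨ cong (_∸ lo) lo+K≡1+top ⟨
      lo + K ∸ lo    ≡⟨ m+n∸m≡n lo K ⟩
      K              ∎
      where open ≤-Reasoning

data Parity : ℕ → Set where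
  even : ∀ k → Parity (k + k)
  odd  : ∀ k → Parity (suc (k + k))

parity : ∀ c → Parity c
parity zero = even zero
parity (suc c) with parity c
... | even k = odd k
... | odd  k = subst Parity (cong suc (+-suc k k)) (even (suc k))

half-< : ∀ {k m} → k + k < m + m → k < m
half-< k+k<m+m = ≰⇒> λ m≤k → <⇒≱ k+k<m+m (+-mono-≤ m≤k m≤k)

-- The covering family of ℤ₂² × ℤ_{4d} for d = 11 + 6s

strand-difference : ∀ {a b d i} → a + d ≡ b → i ≤ a → b + i ∸ (a ∸ i) ≡ d + (i + i)
strand-difference {a} {b} {d} {i} a+d≡b i≤a = begin
  b + i ∸ (a ∸ i)                     ≡⟨ cong (_∸ (a ∸ i)) sum ⟨
  (a ∸ i) + (d + (i + i)) ∸ (a ∸ i)   ≡⟨ m+n∸m≡n (a ∸ i) (d + (i + i)) ⟩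
  d + (i + i)                         ∎
  where
  open ≡-Reasoning
  regroup : ∀ x d i → x + (d + (i + i)) ≡ x + i + d + i
  regroup = solve-∀
  sum : (a ∸ i) + (d + (i + i)) ≡ b + i
  sum = begin
    (a ∸ i) + (d + (i + i)) ≡⟨ regroup (a ∸ i) d i ⟩
    a ∸ i + i + d + i       ≡⟨ cong (λ x → x + d + i) (m∸n+n≡m i≤a) ⟩
    a + d + i               ≡⟨ cong (_+ i) a+d≡b ⟩
    b + i                   ∎

-- α + β ·s stands for α + β s, s being the parameter of the construction. Comparing coefficientwise
-- gives inequalities that hold for every s and are decided by evaluation.
Affine : Set
Affine = ℕ × ℕ

infix 5.5 _+_·s
pattern _+_·s α β = α , β

infixl 6 _+ᴬ_ _-ᴬ_

_+ᴬ_ _-ᴬ_ : Affine → Affine → Affine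
(α + β ·s) +ᴬ (γ + δ ·s) = (α + γ) + (β + δ) ·s
(α + β ·s) -ᴬ (γ + δ ·s) = (α ∸ γ) + (β ∸ δ) ·s

sucᴬ : Affine → Affine
sucᴬ (α + β ·s) = suc α + β ·s

oddᴬ : Affine → Affine
oddᴬ (α + β ·s) = suc (α + α) + (β + β) ·s

infix 4 _≤ᴬ_

_≤ᴬ_ : Affine → Affine → Bool
(α + β ·s) ≤ᴬ (γ + δ ·s) = (α ≤ᵇ γ) ∧ (β ≤ᵇ δ)

≤ᴬ-pred : ∀ x y → T (sucᴬ x ≤ᴬ y) → T (x ≤ᴬ y)
≤ᴬ-pred (α + β ·s) (γ + δ ·s) α<γ∧β≤δ =
  let α<γ , β≤δ = Equivalence.to T-∧ α<γ∧β≤δ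
  in Equivalence.from T-∧ (≤⇒≤ᵇ (<⇒≤ (≤ᵇ⇒≤ (suc α) γ α<γ)) , β≤δ)

_≟ᴬ_ : DecidableEquality Affine
_≟ᴬ_ = Product.≡-dec ℕ._≟_ ℕ._≟_

module Evaluation (s : ℕ) where

  ⟦_⟧ : Affine → ℕ
  ⟦ α + β ·s ⟧ = α + β * s

  ⟦⟧-+ : ∀ x y → ⟦ x ⟧ + ⟦ y ⟧ ≡ ⟦ x +ᴬ y ⟧
  ⟦⟧-+ (α + β ·s) (γ + δ ·s) = regroup α β γ δ s
    where
    regroup : ∀ α β γ δ s → α + β * s + (γ + δ * s) ≡ α + γ + (β + δ) * s
    regroup = solve-∀

  ⟦⟧-≤ : ∀ x y → T (x ≤ᴬ y) → ⟦ x ⟧ ≤ ⟦ y ⟧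
  ⟦⟧-≤ (α + β ·s) (γ + δ ·s) α≤γ∧β≤δ =
    let α≤γ , β≤δ = Equivalence.to T-∧ α≤γ∧β≤δ
    in +-mono-≤ (≤ᵇ⇒≤ α γ α≤γ) (*-monoˡ-≤ s (≤ᵇ⇒≤ β δ β≤δ))

  ⟦⟧-∸ : ∀ x y → T (x ≤ᴬ y) → ⟦ y -ᴬ x ⟧ ≡ ⟦ y ⟧ ∸ ⟦ x ⟧
  ⟦⟧-∸ x@(α + β ·s) y@(γ + δ ·s) x≤y =
    trans (sym (m+n∸m≡n ⟦ x ⟧ ⟦ y -ᴬ x ⟧)) (cong (_∸ ⟦ x ⟧) x+[y-x]≡y)
    where
    α≤γ∧β≤δ : T (α ≤ᵇ γ) × T (β ≤ᵇ δ)
    α≤γ∧β≤δ = Equivalence.to T-∧ x≤y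
    x+[y-x]≡y : ⟦ x ⟧ + ⟦ y -ᴬ x ⟧ ≡ ⟦ y ⟧
    x+[y-x]≡y = trans (⟦⟧-+ x (y -ᴬ x)) (cong₂ (λ a b → ⟦ a + b ·s ⟧)
      (m+[n∸m]≡n (≤ᵇ⇒≤ α γ (proj₁ α≤γ∧β≤δ))) (m+[n∸m]≡n (≤ᵇ⇒≤ β δ (proj₂ α≤γ∧β≤δ))))

Strand : Set
Strand = Affine × Affine × Affine

start end count : Strand → Affine
start (a , _ , _) = a
end   (_ , b , _) = b
count (_ , _ , K) = K

_≟ˢ_ : DecidableEquality Strand
_≟ˢ_ = Product.≡-dec _≟ᴬ_ (Product.≡-dec _≟ᴬ_ _≟ᴬ_)

-- (v , P , w , Q) stands for the block {(0, 0), (v, P), (w, Q)}; as −v = v in ℤ₂², its differences are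
-- (v, ±P), (w, ±Q) and (w − v, ±(Q − P)).
LabelledBlock : Set
LabelledBlock = Vec (Fin 2) 2 × Affine × Vec (Fin 2) 2 × Affine

labelledDifferences : LabelledBlock → List (Vec (Fin 2) 2 × Affine)
labelledDifferences (v , P , w , Q) = (v , P) ∷ (w , Q) ∷ (w ⊖ᵥ v , Q -ᴬ P) ∷ []

_≟ᴸ_ : DecidableEquality (Vec (Fin 2) 2 × Affine)
_≟ᴸ_ = Product.≡-dec (Vec.≡-dec Fin._≟_) _≟ᴬ_

open DecMembership _≟ᴬ_ using () renaming (_∈?_ to _∈ᴬ?_)
open DecMembership _≟ˢ_ using () renaming (_∈?_ to _∈ˢ?_)
open DecMembership _≟ᴸ_ using () renaming (_∈?_ to _∈ᴸ?_)

module Base₁₁₊₆ₛ (s : ℕ) where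
  open Evaluation s

  M h : Affine
  M = 44 + 24 ·s
  h = 22 + 12 ·s

  open HalfSubgroup {43 + 24 * s} {⟦ h ⟧} (⟦⟧-+ h h) (s≤s z≤n)

  -- A strand (a , b , K) stands for the K base blocks {0, a − i, b + i} of ℤ_M, i < K, whose positive
  -- differences are a − i, b + i and b − a + 2i.
  evenRun lowOddRun highOddRun oddBlock₁ oddBlock₂ oddBlock₃ : Strand
  evenRun    = 10 + 6 ·s  , 12 + 6 ·s  , 2 + 2 ·s
  lowOddRun  = 15 + 10 ·s , 18 + 10 ·s , 0 + 1 ·s
  highOddRun = 15 + 9 ·s  , 20 + 11 ·s , 0 + 1 ·s
  oddBlock₁  = 18 + 11 ·s , 19 + 11 ·s , 1 + 0 ·s
  oddBlock₂  = 17 + 10 ·s , 20 + 12 ·s , 1 + 0 ·s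
  oddBlock₃  = 11 + 6 ·s  , 16 + 10 ·s , 1 + 0 ·s

  strands : List Strand
  strands = evenRun ∷ lowOddRun ∷ highOddRun ∷ oddBlock₁ ∷ oddBlock₂ ∷ oddBlock₃ ∷ []

  WellFormed : Strand → Set
  WellFormed (a , b , K) = T ((K ≤ᴬ a) ∧ (sucᴬ a ≤ᴬ b) ∧ (b +ᴬ K ≤ᴬ M))

  strands-wellFormed : All WellFormed strands
  strands-wellFormed = _ ∷ _ ∷ _ ∷ _ ∷ _ ∷ _ ∷ []

  wellFormed⇒ : ∀ {a b K} → WellFormed (a , b , K) →
                ⟦ K ⟧ ≤ ⟦ a ⟧ × ⟦ a ⟧ < ⟦ b ⟧ × ⟦ b ⟧ + ⟦ K ⟧ ≤ ⟦ M ⟧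
  wellFormed⇒ {a} {b} {K} wf =
    let K≤a , rest = Equivalence.to T-∧ wf
        a<b , b+K≤M = Equivalence.to T-∧ rest
    in ⟦⟧-≤ K a K≤a , ⟦⟧-≤ (sucᴬ a) b a<b ,
       subst (_≤ ⟦ M ⟧) (sym (⟦⟧-+ b K)) (⟦⟧-≤ (b +ᴬ K) M b+K≤M)

  blocksOf : Strand → List (ℕ × ℕ)
  blocksOf (a , b , K) = applyUpTo (λ i → ⟦ a ⟧ ∸ i , ⟦ b ⟧ + i) ⟦ K ⟧

  blocks : List (ℕ × ℕ)
  blocks = concatMap blocksOf strands

  specialValues : List Affine
  specialValues = 6 + 4 ·s ∷ 7 + 4 ·s ∷ 8 + 4 ·s ∷ 14 + 8 ·s ∷ 15 + 8 ·s ∷ 21 + 12 ·s ∷ []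

  Covered : ℕ → Set
  Covered c = c ∈ map ⟦_⟧ specialValues ⊎ c ∈ concatMap positiveDifferences blocks

  block∈ : ∀ {a b K i c} → (a , b , K) ∈ strands → i < ⟦ K ⟧ →
           c ∈ positiveDifferences (⟦ a ⟧ ∸ i , ⟦ b ⟧ + i) → Covered c
  block∈ σ∈ i<K c∈ =
    inj₂ (∈-concatMap⁺ positiveDifferences (lose (∈-concatMap⁺ blocksOf (lose σ∈ (∈-applyUpTo⁺ _ i<K))) c∈))

  difference∈ : ∀ {a b K d i} → (a , b , K) ∈ strands → ⟦ a ⟧ + d ≡ ⟦ b ⟧ → i < ⟦ K ⟧ →
                Covered (d + (i + i))
  difference∈ {a} {b} {K} {d} {i} σ∈ a+d≡b i<K =
    subst Covered (strand-difference {⟦ a ⟧} {⟦ b ⟧} {d} {i} a+d≡b i≤a) (block∈ σ∈ i<K (there (there (here refl))))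
    where
    i≤a : i ≤ ⟦ a ⟧
    i≤a = ≤-trans (<⇒≤ i<K) (proj₁ (wellFormed⇒ {a} {b} {K} (All.lookup strands-wellFormed σ∈)))

  lower : ∀ σ {σ∈ : True (σ ∈ˢ? strands)} lo → lo +ᴬ count σ ≡ sucᴬ (start σ) →
          HoldsOn Covered ⟦ lo ⟧ (suc ⟦ start σ ⟧)
  lower (_ , _ , K) {σ∈} lo lo+K≡1+a =
    descending {P = Covered} (trans (⟦⟧-+ lo K) (cong ⟦_⟧ lo+K≡1+a)) λ i<K →
      block∈ (toWitness σ∈) i<K (here refl)

  upper : ∀ σ {σ∈ : True (σ ∈ˢ? strands)} hi → end σ +ᴬ count σ ≡ hi → HoldsOn Covered ⟦ end σ ⟧ ⟦ hi ⟧
  upper (_ , b , K) {σ∈} hi b+K≡hi =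
    ascending {P = Covered} (trans (⟦⟧-+ b K) (cong ⟦_⟧ b+K≡hi)) λ i<K →
      block∈ (toWitness σ∈) i<K (there (here refl))

  special : ∀ c {c∈ : True (c ∈ᴬ? specialValues)} → HoldsOn Covered ⟦ c ⟧ (suc ⟦ c ⟧)
  special c {c∈} = point {P = Covered} (inj₁ (∈-map⁺ ⟦_⟧ (toWitness c∈)))

  Odd : ℕ → Set
  Odd k = Covered (suc (k + k))

  oddRun : ∀ σ {σ∈ : True (σ ∈ˢ? strands)} k₀ hi →
           start σ +ᴬ oddᴬ k₀ ≡ end σ → k₀ +ᴬ count σ ≡ hi → HoldsOn Odd ⟦ k₀ ⟧ ⟦ hi ⟧
  oddRun (a , _ , K) {σ∈} k₀@(α + β ·s) hi a+d≡b k₀+K≡hi =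
    ascending {P = Odd} (trans (⟦⟧-+ k₀ K) (cong ⟦_⟧ k₀+K≡hi)) λ {i} i<K →
      subst Covered (regroup α β s i)
        (difference∈ (toWitness σ∈) (trans (⟦⟧-+ a (oddᴬ k₀)) (cong ⟦_⟧ a+d≡b)) i<K)
    where
    regroup : ∀ α β s i → suc (α + α) + (β + β) * s + (i + i) ≡ suc ((α + β * s + i) + (α + β * s + i))
    regroup = solve-∀

  odds : HoldsOn Odd 0 ⟦ 3 + 2 ·s ⟧
  odds =
    oddRun oddBlock₁   (0 + 0 ·s) (1 + 0 ·s) refl refl ∪
    oddRun lowOddRun   (1 + 0 ·s) (1 + 1 ·s) refl refl ∪
    oddRun oddBlock₂   (1 + 1 ·s) (2 + 1 ·s) refl refl ∪
    oddRun highOddRun  (2 + 1 ·s) (2 + 2 ·s) refl refl ∪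
    oddRun oddBlock₃   (2 + 2 ·s) (3 + 2 ·s) refl refl

  evens : ∀ {i} → i < ⟦ 2 + 2 ·s ⟧ → Covered (suc i + suc i)
  evens {i} i<K =
    subst Covered (cong suc (sym (+-suc i i))) (difference∈ (here refl) (⟦⟧-+ (10 + 6 ·s) (2 + 0 ·s)) i<K)

  differences : HoldsOn Covered 1 ⟦ 6 + 4 ·s ⟧
  differences {c} 0<c c<6+4s with parity c | subst (c <_) (sym (⟦⟧-+ (3 + 2 ·s) (3 + 2 ·s))) c<6+4s
  ... | even zero    | _    = ⊥-elim (<-irrefl refl 0<c)
  ... | even (suc i) | c<2m = evens (s≤s⁻¹ (half-< {suc i} c<2m))
  ... | odd k        | c<2m = odds z≤n (half-< {k} (<-trans (n<1+n (k + k)) c<2m))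

  covered : HoldsOn Covered 1 ⟦ h ⟧
  covered =
    differences ∪
    special (6 + 4 ·s) ∪ special (7 + 4 ·s) ∪ special (8 + 4 ·s) ∪
    lower evenRun (9 + 4 ·s) refl ∪
    lower oddBlock₃ (11 + 6 ·s) refl ∪
    upper evenRun (14 + 8 ·s) refl ∪
    special (14 + 8 ·s) ∪ special (15 + 8 ·s) ∪
    lower highOddRun (16 + 8 ·s) refl ∪
    lower lowOddRun (16 + 9 ·s) refl ∪
    upper oddBlock₃ (17 + 10 ·s) refl ∪
    lower oddBlock₂ (17 + 10 ·s) refl ∪
    upper lowOddRun (18 + 11 ·s) refl ∪
    lower oddBlock₁ (18 + 11 ·s) refl ∪
    upper oddBlock₁ (20 + 11 ·s) refl ∪
    upper highOddRun (20 + 12 ·s) refl ∪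
    upper oddBlock₂ (21 + 12 ·s) refl ∪
    special (21 + 12 ·s)

  cyclicBlocks : List (Triple 0 ⟦ M ⟧)
  cyclicBlocks = map (λ (A , B) → triple₀ [] A [] B) blocks

  block-increasing : ∀ {A B} → (A , B) ∈ blocks → 0 < A × A < B × B < ⟦ M ⟧
  block-increasing AB∈ with find (∈-concatMap⁻ blocksOf {xs = strands} AB∈)
  ... | (a , b , K) , σ∈ , AB∈σ with ∈-applyUpTo⁻ _ AB∈σ
  ... | i , i<K , refl =
    let K≤a , a<b , b+K≤M = wellFormed⇒ {a} {b} {K} (All.lookup strands-wellFormed σ∈)
    in m<n⇒0<n∸m (<-≤-trans i<K K≤a) ,
       ≤-<-trans (m∸n≤m ⟦ a ⟧ i) (<-≤-trans a<b (m≤m+n ⟦ b ⟧ i)) ,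
       <-≤-trans (+-monoʳ-< ⟦ b ⟧ i<K) b+K≤M

  value-covers : ∀ {c z} → c ∈ concatMap positiveDifferences blocks → z ≡± c → ([] , z) ∈ Δ* cyclicBlocks
  value-covers c∈ z≡±c =
    let (A , B) , AB∈ , c∈AB = find (∈-concatMap⁻ positiveDifferences {xs = blocks} c∈)
        0<A , A<B , B<M = block-increasing AB∈
    in ∈Δ*⁺ (∈-map⁺ (λ (A , B) → triple₀ [] A [] B) AB∈) (∈Δ-triple₀-positive 0<A A<B B<M c∈AB z≡±c)

  specialBlocks : List LabelledBlock
  specialBlocks =
    (zero ∷ zero ∷ [] , 8 + 4 ·s  , zero ∷ zero ∷ [] , 14 + 8 ·s)  ∷
    (𝟙 ∷ zero ∷ []    , 8 + 4 ·s  , zero ∷ 𝟙 ∷ []    , 14 + 8 ·s)  ∷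
    (zero ∷ zero ∷ [] , 15 + 8 ·s , 𝟙 ∷ zero ∷ []    , 21 + 12 ·s) ∷
    (zero ∷ 𝟙 ∷ []    , 15 + 8 ·s , zero ∷ zero ∷ [] , 21 + 12 ·s) ∷
    (zero ∷ 𝟙 ∷ []    , 8 + 4 ·s  , 𝟙 ∷ zero ∷ []    , 15 + 8 ·s)  ∷
    (𝟙 ∷ 𝟙 ∷ []       , 8 + 4 ·s  , 𝟙 ∷ 𝟙 ∷ []       , 15 + 8 ·s)  ∷
    (𝟙 ∷ zero ∷ []    , 14 + 8 ·s , 𝟙 ∷ 𝟙 ∷ []       , 21 + 12 ·s) ∷
    (𝟙 ∷ 𝟙 ∷ []       , 14 + 8 ·s , zero ∷ 𝟙 ∷ []    , 21 + 12 ·s) ∷ []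

  specialDifferences : List (Vec (Fin 2) 2 × Affine)
  specialDifferences = concatMap labelledDifferences specialBlocks

  specialValues-labelled : All (λ c → All (λ u → (u , c) ∈ specialDifferences) (allVecs 2)) specialValues
  specialValues-labelled = toWitness {a? = all? (λ c → all? (λ u → (u , c) ∈ᴸ? specialDifferences) (allVecs 2))
                                                  specialValues} _

  Increasing : LabelledBlock → Set
  Increasing (_ , P , _ , Q) = T ((1 + 0 ·s ≤ᴬ P) ∧ (sucᴬ P ≤ᴬ Q) ∧ (sucᴬ Q ≤ᴬ M))

  specialBlocks-increasing : All Increasing specialBlocks
  specialBlocks-increasing = _ ∷ _ ∷ _ ∷ _ ∷ _ ∷ _ ∷ _ ∷ _ ∷ []

  increasing⇒ : ∀ {v P w Q} → Increasing (v , P , w , Q) →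
                0 < ⟦ P ⟧ × ⟦ P ⟧ < ⟦ Q ⟧ × ⟦ Q ⟧ < ⟦ M ⟧ × T (P ≤ᴬ Q)
  increasing⇒ {P = P} {Q = Q} increasing =
    let 0<P , rest = Equivalence.to T-∧ increasing
        P<Q , Q<M  = Equivalence.to T-∧ rest
    in ⟦⟧-≤ (1 + 0 ·s) P 0<P , ⟦⟧-≤ (sucᴬ P) Q P<Q , ⟦⟧-≤ (sucᴬ Q) M Q<M , ≤ᴬ-pred P Q P<Q

  labelledBlock : LabelledBlock → Triple 2 ⟦ M ⟧
  labelledBlock (v , P , w , Q) = triple₀ v ⟦ P ⟧ w ⟦ Q ⟧

  ∈Δ-labelledBlock : ∀ B {u c z} → Increasing B → (u , c) ∈ labelledDifferences B → z ≡± ⟦ c ⟧ →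
                     (u , z) ∈ Δ (labelledBlock B)
  ∈Δ-labelledBlock (v , P , w , Q) {z = z} increasing u,c∈ z≡±c with increasing⇒ {v} {P} {w} {Q} increasing | u,c∈
  ... | 0<P , P<Q , Q<M , _   | here refl                 = ∈Δ-triple₀ˡ v w 0<P P<Q Q<M z≡±c
  ... | 0<P , P<Q , Q<M , _   | there (here refl)         = ∈Δ-triple₀ʳ v w 0<P P<Q Q<M z≡±c
  ... | 0<P , P<Q , Q<M , P≤Q | there (there (here refl)) =
    ∈Δ-triple₀ᵈ v w 0<P P<Q Q<M (subst (z ≡±_) (⟦⟧-∸ P Q P≤Q) z≡±c)

  ∈Δ*-specialBlocks : ∀ {u c z} → (u , c) ∈ specialDifferences → z ≡± ⟦ c ⟧ →
                      (u , z) ∈ Δ* (map labelledBlock specialBlocks)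
  ∈Δ*-specialBlocks u,c∈ z≡±c =
    let B , B∈ , u,c∈B = find (∈-concatMap⁻ labelledDifferences {xs = specialBlocks} u,c∈)
    in ∈Δ*⁺ (∈-map⁺ labelledBlock B∈) (∈Δ-labelledBlock B (All.lookup specialBlocks-increasing B∈) u,c∈B z≡±c)

  special-covers : ∀ {c} → c ∈ specialValues → ∀ (u : Vec (Fin 2) 2) {z} → z ≡± ⟦ c ⟧ →
                   (u , z) ∈ Δ* (map labelledBlock specialBlocks)
  special-covers c∈ u = ∈Δ*-specialBlocks (All.lookup (All.lookup specialValues-labelled c∈) (∈-allVecs u))

  labelledCyclicBlocks : List (Triple 2 ⟦ M ⟧)
  labelledCyclicBlocks = Lift.lift orthomorphism₂ cyclicBlocks

  base : List (Triple 2 ⟦ M ⟧)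
  base = labelledCyclicBlocks ++ map labelledBlock specialBlocks

  base-covers : Covers (H 2) base
  base-covers (u , z) z∉H = let c , 0<c , c<h , z≡±c = ∉H⇒≡± z∉H in covers-at (covered 0<c c<h) z≡±c
    where
    covers-at : ∀ {c} → Covered c → z ≡± c → (u , z) ∈ Δ* base
    covers-at (inj₁ c∈specials) z≡±c =
      let c′ , c′∈ , c≡c′ = ∈-map⁻ ⟦_⟧ {xs = specialValues} c∈specials
      in ∈Δ*-++⁺ʳ labelledCyclicBlocks _ (special-covers c′∈ u (subst (z ≡±_) c≡c′ z≡±c))
    covers-at (inj₂ c∈values) z≡±c =
      ∈Δ*-++⁺ˡ labelledCyclicBlocks _ (Lift.∈Δ*-lift orthomorphism₂ cyclicBlocks (value-covers c∈values z≡±c) u)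

  length-blocks : length blocks ≡ ⟦ 5 + 4 ·s ⟧
  length-blocks = go strands
    where
    totalCount : List Strand → Affine
    totalCount = foldr (λ σ K → count σ +ᴬ K) (0 + 0 ·s)
    go : ∀ σs → length (concatMap blocksOf σs) ≡ ⟦ totalCount σs ⟧
    go []                   = refl
    go (σ@(_ , _ , K) ∷ σs) = begin
      length (blocksOf σ ++ concatMap blocksOf σs)         ≡⟨ length-++ (blocksOf σ) ⟩
      length (blocksOf σ) + length (concatMap blocksOf σs) ≡⟨ cong₂ _+_ (length-applyUpTo _ ⟦ K ⟧) (go σs) ⟩
      ⟦ K ⟧ + ⟦ totalCount σs ⟧                            ≡⟨ ⟦⟧-+ K (totalCount σs) ⟩
      ⟦ K +ᴬ totalCount σs ⟧                               ∎
      where open ≡-Reasoning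

  length-base : 6 * length base + 8 ≡ 4 * ⟦ M ⟧
  length-base = begin
    6 * length base + 8
      ≡⟨ cong (λ x → 6 * x + 8) (length-++ labelledCyclicBlocks) ⟩
    6 * (length labelledCyclicBlocks + 8) + 8
      ≡⟨ cong (λ x → 6 * (x + 8) + 8) (Lift.length-lift orthomorphism₂ cyclicBlocks) ⟩
    6 * (length cyclicBlocks * 4 + 8) + 8
      ≡⟨ cong (λ x → 6 * (x * 4 + 8) + 8) (trans (length-map _ blocks) length-blocks) ⟩
    6 * ((5 + 4 * s) * 4 + 8) + 8
      ≡⟨ count-identity s ⟩
    4 * (44 + 24 * s)
      ∎
    where
    open ≡-Reasoning
    count-identity : ∀ s → 6 * ((5 + 4 * s) * 4 + 8) + 8 ≡ 4 * (44 + 24 * s)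
    count-identity = solve-∀

  differenceFamily : ∀ k → k ≢ 1 → DifferenceFamily (3 + k) (2 + k) ⟦ M ⟧
  differenceFamily k k≢1 = lift-differenceFamily (orthomorphism k k≢1) {base} base-covers length-base

-- d = 5 would need s = −1 above.
module Base₂₀ where
  open HalfSubgroup {19} {10} refl (s≤s z≤n)

  base : List (Triple 2 20)
  base =
    triple₀ (zero ∷ 𝟙 ∷ []) 15 (zero ∷ 𝟙 ∷ []) 17 ∷
    triple₀ (zero ∷ 𝟙 ∷ []) 7 (zero ∷ 𝟙 ∷ []) 11 ∷
    triple₀ (zero ∷ zero ∷ []) 8 (𝟙 ∷ zero ∷ []) 12 ∷
    triple₀ (𝟙 ∷ zero ∷ []) 13 (zero ∷ zero ∷ []) 19 ∷
    triple₀ (𝟙 ∷ zero ∷ []) 1 (zero ∷ 𝟙 ∷ []) 18 ∷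
    triple₀ (zero ∷ 𝟙 ∷ []) 8 (zero ∷ zero ∷ []) 9 ∷
    triple₀ (zero ∷ zero ∷ []) 15 (𝟙 ∷ zero ∷ []) 17 ∷
    triple₀ (𝟙 ∷ zero ∷ []) 9 (zero ∷ 𝟙 ∷ []) 14 ∷
    triple₀ (𝟙 ∷ 𝟙 ∷ []) 1 (zero ∷ 𝟙 ∷ []) 16 ∷
    triple₀ (𝟙 ∷ 𝟙 ∷ []) 4 (zero ∷ zero ∷ []) 17 ∷
    triple₀ (𝟙 ∷ 𝟙 ∷ []) 8 (zero ∷ zero ∷ []) 14 ∷
    triple₀ (zero ∷ zero ∷ []) 7 (𝟙 ∷ 𝟙 ∷ []) 18 ∷ []

  differenceFamily : ∀ k → k ≢ 1 → DifferenceFamily (3 + k) (2 + k) 20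
  differenceFamily k k≢1 = lift-differenceFamily (orthomorphism k k≢1) {base} (covers-by-search (H 2) base) refl

differenceFamily : ∀ k → k ≢ 1 → ∀ q → DifferenceFamily (3 + k) (2 + k) (4 * (5 + q * 6))
differenceFamily k k≢1 zero    = Base₂₀.differenceFamily k k≢1
differenceFamily k k≢1 (suc s) =
  subst (DifferenceFamily (3 + k) (2 + k)) (M≡ s) (Base₁₁₊₆ₛ.differenceFamily s k k≢1)
  where
  M≡ : ∀ s → 44 + 24 * s ≡ 4 * (5 + suc s * 6)
  M≡ = solve-∀

proposition3p5 : (m d : ℕ) → 3 ≤ m → m ≢ 4 → d % 6 ≡ 5 →
    Σ (Elem2Subgroup m (m ∸ 1) (4 * d)) λ H →
      Σ (List (Triple (m ∸ 1) (4 * d))) λ 𝒯 → IsDifferenceFamily H 𝒯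
proposition3p5 (suc (suc (suc k))) d (s≤s (s≤s (s≤s _))) m≢4 d%6≡5 =
  subst (λ d → DifferenceFamily (3 + k) (2 + k) (4 * d)) (sym d≡5+q*6) (differenceFamily k k≢1 (d / 6))
  where
  k≢1 : k ≢ 1
  k≢1 k≡1 = m≢4 (cong (3 +_) k≡1)
  d≡5+q*6 : d ≡ 5 + d / 6 * 6
  d≡5+q*6 = trans (m≡m%n+[m/n]*n d 6) (cong (_+ d / 6 * 6) d%6≡5)
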